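{- Let $G=(V,E)$ be a de Bruijn multigraph with $m=|E|$ and let $c$ be an interval function on its edges. If $G$ has a $c$-respecting Eulerian trail, then $G$ has a $c$-respecting Eulerian trail $W=e_1\dots e_m$ such that for every time step $t$ for which $e_t$ has a parallel edge $e'$ that is also available at $t$ and appears after $e_t$ on $W$, we have $\max c(e_t)\le\max c(e')$.
   Context: A de Bruijn multigraph of order $k$ over an alphabet $\Sigma$ is a directed multigraph whose nodes are strings of length $k-1$ over $\Sigma$ and every edge from $u$ to $v$ satisfies $u[2\,..\,k-1]=v[1\,..\,k-2]$; parallel edges (distinct edges with the same tail and head) are allowed. An interval function assigns to each edge $e$ a nonempty or empty interval $c(e)$ of consecutive integers in $[1,m]$; $e$ is available at $t$ if $t\in c(e)$. An Eulerian trail is a sequence $e_1\dots e_m$ of edges forming a directed walk using every edge exactly once; it is $c$-respecting if $t\in c(e_t)$ for all $t\in[m]$. -}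

module Defs where

open import Data.Nat using (ℕ; zero; suc; _≤_; _<_; _∸_)
open import Data.Fin using (Fin; toℕ)
open import Data.Vec using (Vec; toList)
open import Data.List using (drop; take)
open import Data.Maybe using (Maybe; just; nothing)
open import Data.Product using (_×_; _,_; Σ; ∃; ∃-syntax; proj₁)
open import Data.Unit using (⊤)
open import Data.Empty using (⊥)
open import Relation.Binary.PropositionalEquality using (_≡_; _≢_)
open import Relation.Nullary using (¬_)
open import Function.Bundles using (_↔_; Inverse)

-- Alphabet Σ = Fin s.  Nodes are strings of length n (= k - 1).
Node : ℕ → ℕ → Set
Node s n = Vec (Fin s) n

DBAdj : ∀ {s n} → Node s n → Node s n → Set
DBAdj {n = n} u v = drop 1 (toList u) ≡ take (n ∸ 1) (toList v)

record DeBruijnMultigraph (s n m : ℕ) : Set where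
  field
    tl  : Fin m → Node s n
    hd  : Fin m → Node s n
    adj : ∀ e → DBAdj (tl e) (hd e)
open DeBruijnMultigraph public

-- An interval of integers: nothing = empty, just (a , b) = {a, ..., b}.
Interval : Set
Interval = Maybe (ℕ × ℕ)

WithinRange : ℕ → Interval → Set
WithinRange m nothing = ⊤
WithinRange m (just (a , b)) = (1 ≤ a) × (a ≤ b) × (b ≤ m)

_∈I_ : ℕ → Interval → Set
t ∈I nothing = ⊥
t ∈I just (a , b) = (a ≤ t) × (t ≤ b)

-- max of an interval (only meaningful for nonempty intervals).
maxI : Interval → ℕ
maxI nothing = 0
maxI (just (_ , b)) = b

IntervalFunction : ℕ → Set
IntervalFunction m = Σ (Fin m → Interval) λ c → ∀ e → WithinRange m (c e)

Available : ∀ {m} → IntervalFunction m → Fin m → ℕ → Set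
Available (c , _) e t = t ∈I c e

-- Eulerian trail: a bijection W : positions (Fin m, position i = time i+1) → edges,
-- forming a directed walk.
record EulerianTrail {s n m} (G : DeBruijnMultigraph s n m) : Set where
  field
    W     : Fin m ↔ Fin m
    walk  : ∀ (i j : Fin m) → suc (toℕ i) ≡ toℕ j →
            hd G (Inverse.to W i) ≡ tl G (Inverse.to W j)
open EulerianTrail public

edgeAt : ∀ {s n m} {G : DeBruijnMultigraph s n m} → EulerianTrail G → Fin m → Fin m
edgeAt T i = Inverse.to (W T) i

Respecting : ∀ {s n m} {G : DeBruijnMultigraph s n m} →
             IntervalFunction m → EulerianTrail G → Set
Respecting c T = ∀ i → Available c (edgeAt T i) (suc (toℕ i))

Parallel : ∀ {s n m} → DeBruijnMultigraph s n m → Fin m → Fin m → Set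
Parallel G e e' = (e ≢ e') × (tl G e ≡ tl G e') × (hd G e ≡ hd G e')

MaxOrdered : ∀ {s n m} {G : DeBruijnMultigraph s n m} →
             IntervalFunction m → EulerianTrail G → Set
MaxOrdered {m = m} {G = G} c T =
  ∀ (i j : Fin m) → toℕ i < toℕ j →
  Parallel G (edgeAt T i) (edgeAt T j) →
  Available c (edgeAt T j) (suc (toℕ i)) →
  maxI (proj₁ c (edgeAt T i)) ≤ maxI (proj₁ c (edgeAt T j))

-- Process the positions of a c-respecting Eulerian trail from left to right.
-- While the current position i has a later parallel edge e_j that is available
-- at time i+1 and has a strictly smaller deadline max c(e_j), exchange e_i and e_j.
-- Parallel edges have the same endpoints, so the result is again an Eulerian
-- trail; it is still c-respecting because e_i, whose interval starts no later
-- than i+1, stays available up to its deadline, which exceeds max c(e_j) ≥ j+1.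
-- Each exchange lowers the deadline at position i and leaves all earlier
-- positions, and the set of positions after each of them, untouched.
module Submission where

open import Defs
open import Data.Nat using (ℕ; zero; suc; _≤_; _<_; _≤?_)
open import Data.Nat.Properties using (≤-refl; ≤-trans; <-trans; <⇒≤; <⇒≢; ≮⇒≥; m≤n⇒m≤1+n; m<1+n⇒m<n∨m≡n)
open import Data.Nat.Induction using (<-wellFounded)
open import Data.Fin using (Fin; toℕ; fromℕ<)
open import Data.Fin.Properties using (_≟_; any?; toℕ-injective; toℕ-fromℕ<; toℕ<n)
import Data.Fin.Permutation as Permutation
open import Data.Fin.Permutation.Components using (transpose)
open import Data.Vec.Properties using (≡-dec)
open import Data.Maybe using (just; nothing)
open import Data.Product using (Σ; ∃; _×_; _,_; proj₁; proj₂)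
open import Data.Sum using (inj₁; inj₂)
open import Data.Empty using (⊥-elim)
open import Induction.WellFounded using (Acc; acc)
open import Relation.Nullary using (Dec; yes; no; ¬_)
open import Relation.Nullary.Decidable using (_×-dec_; ¬?)
open import Relation.Binary.PropositionalEquality using (_≡_; _≢_; refl; sym; trans; subst)

_∈I?_ : ∀ t I → Dec (t ∈I I)
t ∈I? nothing      = no λ ()
t ∈I? just (a , b) = (a ≤? t) ×-dec (t ≤? b)

∈I⇒≤maxI : ∀ {t} I → t ∈I I → t ≤ maxI I
∈I⇒≤maxI (just _) (_ , t≤b) = t≤b

∈I-widenʳ : ∀ {t t'} I → t ∈I I → t ≤ t' → t' ≤ maxI I → t' ∈I I
∈I-widenʳ (just _) (a≤t , _) t≤t' t'≤b = ≤-trans a≤t t≤t' , t'≤b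

transpose-elim : ∀ {m} {i j : Fin m} (P : Fin m → Fin m → Set) →
                 P i j → P j i → (∀ k → k ≢ i → k ≢ j → P k k) →
                 ∀ k → P k (transpose i j k)
transpose-elim {i = i} {j} P Pij Pji Pkk k with k ≟ i
... | yes refl = Pij
... | no k≢i with k ≟ j
...   | yes refl = Pji
...   | no k≢j   = Pkk k k≢i k≢j

transpose-matchˡ : ∀ {m} (i j : Fin m) → transpose i j i ≡ j
transpose-matchˡ i j with i ≟ i
... | yes _  = refl
... | no i≢i = ⊥-elim (i≢i refl)

transpose-mismatch : ∀ {m} {i j k : Fin m} → k ≢ i → k ≢ j → transpose i j k ≡ k
transpose-mismatch {i = i} {j} {k} k≢i k≢j with k ≟ i
... | yes k≡i = ⊥-elim (k≢i k≡i)
... | no _ with k ≟ j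
...   | yes k≡j = ⊥-elim (k≢j k≡j)
...   | no _    = refl

module _ {s n m : ℕ} {G : DeBruijnMultigraph s n m} where

  SameEnds : Fin m → Fin m → Set
  SameEnds e e' = (tl G e ≡ tl G e') × (hd G e ≡ hd G e')

  swap : (T : EulerianTrail G) (i j : Fin m) → SameEnds (edgeAt T i) (edgeAt T j) →
         EulerianTrail G
  swap T i j (tl≡ , hd≡) = record
    { W    = Permutation.transpose i j Permutation.∘ₚ W T
    ; walk = λ p q p+1≡q →
        trans (proj₂ (sameEnds p)) (trans (walk T p q p+1≡q) (sym (proj₁ (sameEnds q))))
    }
    where
    sameEnds : ∀ p → SameEnds (edgeAt T (transpose i j p)) (edgeAt T p)
    sameEnds = transpose-elim (λ p τp → SameEnds (edgeAt T τp) (edgeAt T p))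
                 (sym tl≡ , sym hd≡) (tl≡ , hd≡) (λ _ _ _ → refl , refl)

module _ {s n m : ℕ} {G : DeBruijnMultigraph s n m} (c : IntervalFunction m) where

  deadline : EulerianTrail G → Fin m → ℕ
  deadline T i = maxI (proj₁ c (edgeAt T i))

  MaxOrderedAt : EulerianTrail G → Fin m → Set
  MaxOrderedAt T i = ∀ j → toℕ i < toℕ j →
    Parallel G (edgeAt T i) (edgeAt T j) →
    Available c (edgeAt T j) (suc (toℕ i)) →
    deadline T i ≤ deadline T j

  MaxOrderedBelow : EulerianTrail G → ℕ → Set
  MaxOrderedBelow T k = ∀ i → toℕ i < k → MaxOrderedAt T i

  Settled : ℕ → EulerianTrail G → Set
  Settled k T = Respecting c T × MaxOrderedBelow T k

  Violation : EulerianTrail G → Fin m → Fin m → Set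
  Violation T i j = toℕ i < toℕ j × Parallel G (edgeAt T i) (edgeAt T j) ×
    Available c (edgeAt T j) (suc (toℕ i)) × deadline T j < deadline T i

  violation? : ∀ T i j → Dec (Violation T i j)
  violation? T i j =
    (suc (toℕ i) ≤? toℕ j) ×-dec
    ((¬? (edgeAt T i ≟ edgeAt T j) ×-dec (≡-dec _≟_ _ _ ×-dec ≡-dec _≟_ _ _)) ×-dec
    ((suc (toℕ i) ∈I? proj₁ c (edgeAt T j)) ×-dec (suc (deadline T j) ≤? deadline T i)))

  noViolation⇒maxOrderedAt : ∀ T i → ¬ ∃ (Violation T i) → MaxOrderedAt T i
  noViolation⇒maxOrderedAt T i none j i<j par avail =
    ≮⇒≥ λ smaller → none (j , i<j , par , avail , smaller)

  resolve : ∀ T i j → Violation T i j → EulerianTrail G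
  resolve T i j (_ , (_ , sameEnds) , _) = swap T i j sameEnds

  resolve-decreasesDeadline : ∀ T i j (v : Violation T i j) →
                              deadline (resolve T i j v) i < deadline T i
  resolve-decreasesDeadline T i j (_ , _ , _ , smaller) =
    subst (λ p → maxI (proj₁ c (edgeAt T p)) < deadline T i) (sym (transpose-matchˡ i j)) smaller

  resolve-respecting : ∀ T i j (v : Violation T i j) →
                       Respecting c T → Respecting c (resolve T i j v)
  resolve-respecting T i j (i<j , _ , avail , smaller) resp =
    transpose-elim (λ p τp → Available c (edgeAt T τp) (suc (toℕ p)))
      avail
      (∈I-widenʳ (proj₁ c (edgeAt T i)) (resp i) (m≤n⇒m≤1+n i<j)
        (≤-trans (∈I⇒≤maxI (proj₁ c (edgeAt T j)) (resp j)) (<⇒≤ smaller)))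
      (λ p _ _ → resp p)

  resolve-maxOrderedBelow : ∀ T i j (v : Violation T i j) →
                            MaxOrderedBelow T (toℕ i) → MaxOrderedBelow (resolve T i j v) (toℕ i)
  resolve-maxOrderedBelow T i j (i<j , _) ordered p p<i q p<q =
    subst (λ p' → Parallel G (edgeAt T p') (edgeAt T τq) →
                  Available c (edgeAt T τq) (suc (toℕ p)) →
                  maxI (proj₁ c (edgeAt T p')) ≤ deadline T τq)
          (sym fixed) (ordered p p<i τq (staysAfter q p<q))
    where
    τq : Fin m
    τq = transpose i j q

    fixed : transpose i j p ≡ p
    fixed = transpose-mismatch (λ { refl → <⇒≢ p<i refl })
                               (λ { refl → <⇒≢ (<-trans p<i i<j) refl })

    staysAfter : ∀ q → toℕ p < toℕ q → toℕ p < toℕ (transpose i j q)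
    staysAfter = transpose-elim (λ q τq → toℕ p < toℕ q → toℕ p < toℕ τq)
                   (λ _ → <-trans p<i i<j) (λ _ → p<i) (λ _ _ _ p<q → p<q)

  settleAt : ∀ i T → Acc _<_ (deadline T i) → Settled (toℕ i) T →
             Σ (EulerianTrail G) λ T' → Settled (toℕ i) T' × MaxOrderedAt T' i
  settleAt i T (acc smaller) (resp , ordered) with any? (violation? T i)
  ... | no none    = T , (resp , ordered) , noViolation⇒maxOrderedAt T i none
  ... | yes (j , v) = settleAt i (resolve T i j v) (smaller (resolve-decreasesDeadline T i j v))
                        (resolve-respecting T i j v resp , resolve-maxOrderedBelow T i j v ordered)

  maxOrderedBelow-suc : ∀ T i → MaxOrderedBelow T (toℕ i) → MaxOrderedAt T i →
                        MaxOrderedBelow T (suc (toℕ i))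
  maxOrderedBelow-suc T i below at p p<1+i with m<1+n⇒m<n∨m≡n p<1+i
  ... | inj₁ p<i = below p p<i
  ... | inj₂ p≡i = subst (MaxOrderedAt T) (sym (toℕ-injective p≡i)) at

  settleBelow : Σ (EulerianTrail G) (Respecting c) →
                ∀ k → k ≤ m → Σ (EulerianTrail G) (Settled k)
  settleBelow (T , resp) zero _ = T , resp , λ _ ()
  settleBelow T₀ (suc k) k<m with settleBelow T₀ k (<⇒≤ k<m) | fromℕ< k<m | toℕ-fromℕ< k<m
  ... | T , settled | i | refl with settleAt i T (<-wellFounded _) settled
  ...   | T' , (resp , below) , at = T' , resp , maxOrderedBelow-suc T' i below at

mainTheorem10 : (s n m : ℕ) (G : DeBruijnMultigraph s n m) (c : IntervalFunction m) →
    Σ (EulerianTrail G) (Respecting c) →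
    Σ (EulerianTrail G) (λ T → Respecting c T × MaxOrdered c T)
mainTheorem10 s n m G c T₀ with settleBelow c T₀ m ≤-refl
... | T , resp , below = T , resp , λ i → below i (toℕ<n i)
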